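{- Let $r_0,t_0$ be integers with $2\le t_0\le r_0$, and let $\Delta_0\ge 0$ be a real number such that $\Delta(n_0,r_0,t_0)/n_0\le\Delta_0$ for all positive integers $n_0$. Let $n,k\ge 2$ be integers and set $r:=r_0k$ and $t:=k+t_0$. Then there exists an $r$-partite graph $G$ with parts of size $n$ such that $G$ contains no crossing independent set of size $t$ and $$\Delta(G)\le (r_0-1)\left\lceil\frac{\Delta_0+(k-1)r_0}{\Delta_0+kr_0-1}\cdot n\right\rceil.$$ That is, $\Delta(n,r,t)\le (r_0-1)\left\lceil\frac{\Delta_0+(k-1)r_0}{\Delta_0+kr_0-1}\cdot n\right\rceil$, or equivalently $f(n,r,t)\ge (r-1)n-(r_0-1)\left\lceil\frac{\Delta_0+(k-1)r_0}{\Delta_0+kr_0-1}\cdot n\right\rceil$.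
   Context: For positive integers $n,r$, an $r$-partite graph with parts of size $n$ is a graph $G$ whose vertex set is partitioned into $r$ independent sets $V_1,\dots,V_r$ (its parts), each of size $n$. A set $S\subseteq V(G)$ is crossing if $|S\cap V_i|\le 1$ for every part $V_i$. $\Delta(n,r,s)$ denotes the smallest maximum degree $\Delta(G)$ among all $r$-partite graphs $G$ with parts of size $n$ that contain no crossing independent set of size $s$. $f(n,r,s)$ denotes the largest minimum degree $\delta(G)$ among all $r$-partite graphs $G$ with parts of size $n$ that contain no copy of $K_s$; one has $\Delta(n,r,s)=(r-1)n-f(n,r,s)$.
   Formalization: The parameter $\Delta_0$ ranges over the nonnegative rationals instead of the real numbers. -}

module Defs where

open import Data.Bool using (Bool; true; false; if_then_else_)
open import Data.Nat as ℕ using (ℕ; zero; suc; _∸_; z≤n; s≤s)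
import Data.Nat.Properties as ℕP
open import Data.Fin using (Fin; zero; suc)
open import Data.Integer as ℤ using (ℤ; +_)
open import Data.Rational as ℚ using (ℚ; 0ℚ; _/_; _÷_)
import Data.Rational.Properties as ℚP
open import Data.Product using (Σ; ∃; _×_; _,_)
open import Relation.Binary.PropositionalEquality using (_≡_; _≢_; refl)
open import Relation.Nullary using (¬_)

-- An r-partite graph with parts V_1..V_r of size n.  Vertex (i , a) is the
-- a-th vertex of part i.
record PGraph (r n : ℕ) : Set where
  field
    adj       : Fin r → Fin n → Fin r → Fin n → Bool
    adj-sym   : ∀ i a j b → adj i a j b ≡ adj j b i a
    part-indep : ∀ i a b → adj i a i b ≡ false
open PGraph public

sumFin : (m : ℕ) → (Fin m → ℕ) → ℕ
sumFin zero    f = 0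
sumFin (suc m) f = f zero ℕ.+ sumFin m (λ x → f (suc x))

deg : ∀ {r n} → PGraph r n → Fin r → Fin n → ℕ
deg {r} {n} G i a =
  sumFin r (λ j → sumFin n (λ b → if adj G i a j b then 1 else 0))

HasCrossingIndep : ∀ {r n} → PGraph r n → ℕ → Set
HasCrossingIndep {r} {n} G s =
  Σ (Fin s → Fin r) λ part → Σ (Fin s → Fin n) λ vtx →
    (∀ x y → x ≢ y → part x ≢ part y) ×
    (∀ x y → x ≢ y → adj G (part x) (vtx x) (part y) (vtx y) ≡ false)

MaxDeg≤ℤ : ∀ {r n} → PGraph r n → ℤ → Set
MaxDeg≤ℤ G D = ∀ i a → + (deg G i a) ℤ.≤ D

MaxDeg≤ℚ : ∀ {r n} → PGraph r n → ℚ → Set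
MaxDeg≤ℚ G D = ∀ i a → (+ (deg G i a) / 1) ℚ.≤ D

nℚ : ℕ → ℚ
nℚ m = + m / 1

den : ℚ → ℕ → ℕ → ℚ
den Δ₀ r₀ k = Δ₀ ℚ.+ nℚ (k ℕ.* r₀ ∸ 1)

num : ℚ → ℕ → ℕ → ℚ
num Δ₀ r₀ k = Δ₀ ℚ.+ nℚ ((k ∸ 1) ℕ.* r₀)

private
  lemma : ∀ r₀ k → 2 ℕ.≤ r₀ → 2 ℕ.≤ k → 1 ℕ.≤ k ℕ.* r₀ ∸ 1
  lemma (suc (suc r)) (suc (suc k)) (s≤s (s≤s z≤n)) (s≤s (s≤s z≤n)) = s≤s z≤n

  pos-suc : ∀ m → 0ℚ ℚ.< nℚ (suc m)
  pos-suc m = ℚP.positive⁻¹ (nℚ (suc m)) {{ℚP.normalize-pos (suc m) 1}}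

  pos-nat : ∀ m → 1 ℕ.≤ m → 0ℚ ℚ.< nℚ m
  pos-nat (suc m) _ = pos-suc m

den-pos : ∀ Δ₀ r₀ k → 0ℚ ℚ.≤ Δ₀ → 2 ℕ.≤ r₀ → 2 ℕ.≤ k → 0ℚ ℚ.< den Δ₀ r₀ k
den-pos Δ₀ r₀ k h0 hr hk =
  ℚP.+-mono-≤-< h0 (pos-nat (k ℕ.* r₀ ∸ 1) (lemma r₀ k hr hk))

bound : (Δ₀ : ℚ) (r₀ k n : ℕ) → 0ℚ ℚ.< den Δ₀ r₀ k → ℤ
bound Δ₀ r₀ k n p =
  + (r₀ ∸ 1) ℤ.* ℚ.ceiling ((_÷_ (num Δ₀ r₀ k) (den Δ₀ r₀ k) {{ℚ.>-nonZero p}}) ℚ.* nℚ n)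

{-# OPTIONS --safe #-}
-- Let m = ⌈(Δ₀ + (k-1)r₀)/(Δ₀ + kr₀ - 1) · n⌉ and b = n - m, and let G₀ be a graph
-- with r₀ parts of size b, no crossing independent t₀-set and maximum degree at most Δ₀b.
-- Group the r₀k parts into k layers of r₀ parts each. Each part gets b vertices of G₀ and
-- m padding vertices. Inside a layer, the G₀-vertices span a copy of G₀ and the padding
-- vertices span a complete r₀-partite graph. G₀-vertices in different layers are all adjacent.
-- Take a crossing independent set of size k + t₀. Either t₀ of its vertices are G₀-vertices,
-- which must all lie in one layer and so form a crossing independent t₀-set of G₀. Or k + 1
-- of them are padding vertices, and then two of them lie in the same layer and are adjacent.
-- A padding vertex has degree (r₀-1)m. A G₀-vertex has degree at most Δ₀b + (k-1)r₀b, and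
-- m is chosen exactly so that this is at most (r₀-1)m as well.
module Submission where

open import Defs
open import Data.Nat using (ℕ; _≤_; _*_; _+_)
open import Data.Nat.Properties using (≤-trans)
open import Data.Rational using (ℚ; 0ℚ)
import Data.Rational as ℚ
open import Data.Product using (∃; _×_)
open import Relation.Nullary using (¬_)

open import Data.Nat as ℕ using (zero; suc; _∸_; _⊓_; z≤n; s≤s)
import Data.Nat.Properties as ℕP
open import Data.Integer as ℤ using (∣_∣)
import Data.Integer.Properties as ℤP
open import Data.Integer.DivMod using ([n/d]*d≤n)
open import Data.Rational using (_/_; _÷_; floor; ceiling; *≤*)
open import Data.Rational.Literals using (fromℤ)
import Data.Rational.Properties as ℚP
open import Data.Rational.Solver using (module +-*-Solver)
open import Data.Fin using (Fin; zero; suc; splitAt; remQuot; quotRem; combine; lift)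
import Data.Fin.Properties as FP
open import Data.Bool using (Bool; true; false; if_then_else_; not)
open import Data.Product using (_,_; proj₁; proj₂; uncurry)
import Data.Product as Product
open import Data.Sum using (_⊎_; inj₁; inj₂; [_,_]′)
import Data.Sum as Sum
open import Data.Empty using (⊥)
open import Function using (_∘_; mk⇔)
open import Function.Definitions using (Injective)
open import Relation.Nullary using (does; yes; no; contradiction)
open import Relation.Nullary.Decidable using (dec-true; does-⇔)
open import Relation.Binary.PropositionalEquality
open import Algebra.Properties.Group ℚP.+-0-group using (⁻¹-involutive)
open import Algebra.Properties.CommutativeSemigroup ℕP.+-commutativeSemigroup
  using (interchange; x∙yz≈y∙xz)

-- Integers and natural numbers inside ℚ

/1≡fromℤ : ∀ i → i / 1 ≡ fromℤ i
/1≡fromℤ i = ℚP.↥p/↧p≡p (fromℤ i)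

fromℤ-neg : ∀ i → fromℤ (ℤ.- i) ≡ ℚ.- fromℤ i
fromℤ-neg ℤ.-[1+ _ ] = refl
fromℤ-neg ℤ.+0       = refl
fromℤ-neg ℤ.+[1+ _ ] = refl

/1-cancel-≤ : ∀ {i j} → i / 1 ℚ.≤ j / 1 → i ℤ.≤ j
/1-cancel-≤ {i} {j} i≤j with *≤* i*1≤j*1 ← subst₂ ℚ._≤_ (/1≡fromℤ i) (/1≡fromℤ j) i≤j =
  subst₂ ℤ._≤_ (ℤP.*-identityʳ i) (ℤP.*-identityʳ j) i*1≤j*1

floor-≤ : ∀ p → fromℤ (floor p) ℚ.≤ p
floor-≤ p@record{} =
  *≤* (subst (floor p ℤ.* ℚ.↧ p ℤ.≤_) (sym (ℤP.*-identityʳ (ℚ.↥ p))) ([n/d]*d≤n (ℚ.↥ p) (ℚ.↧ p)))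

≤-ceiling : ∀ p → p ℚ.≤ ceiling p / 1
≤-ceiling p@record{} =
  subst₂ ℚ._≤_ (⁻¹-involutive p) (trans (sym (fromℤ-neg (floor (ℚ.- p)))) (sym (/1≡fromℤ (ceiling p))))
    (ℚP.neg-antimono-≤ (floor-≤ (ℚ.- p)))

ceiling-nonNeg : ∀ {p} → 0ℚ ℚ.≤ p → ℤ.+ ∣ ceiling p ∣ ≡ ceiling p
ceiling-nonNeg {p} 0≤p = ℤP.0≤i⇒+∣i∣≡i (/1-cancel-≤ (ℚP.≤-trans 0≤p (≤-ceiling p)))

nℚ-+ : ∀ a b → nℚ (a + b) ≡ nℚ a ℚ.+ nℚ b
nℚ-+ a b = begin
  ℤ.+ (a + b) / 1                ≡⟨ cong (_/ 1) (trans (ℤP.pos-+ a b)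
                                    (sym (cong₂ ℤ._+_ (ℤP.*-identityʳ (ℤ.+ a)) (ℤP.*-identityʳ (ℤ.+ b))))) ⟩
  fromℤ (ℤ.+ a) ℚ.+ fromℤ (ℤ.+ b)  ≡⟨ cong₂ ℚ._+_ (/1≡fromℤ (ℤ.+ a)) (/1≡fromℤ (ℤ.+ b)) ⟨
  nℚ a ℚ.+ nℚ b                ∎
  where open ≡-Reasoning

nℚ-* : ∀ a b → nℚ (a * b) ≡ nℚ a ℚ.* nℚ b
nℚ-* a b = begin
  ℤ.+ (a * b) / 1                ≡⟨ cong (_/ 1) (ℤP.pos-* a b) ⟩
  fromℤ (ℤ.+ a) ℚ.* fromℤ (ℤ.+ b)  ≡⟨ cong₂ ℚ._*_ (/1≡fromℤ (ℤ.+ a)) (/1≡fromℤ (ℤ.+ b)) ⟨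
  nℚ a ℚ.* nℚ b                ∎
  where open ≡-Reasoning

nℚ-cancel-≤ : ∀ {a b} → nℚ a ℚ.≤ nℚ b → a ≤ b
nℚ-cancel-≤ = ℤP.drop‿+≤+ ∘ /1-cancel-≤

0≤nℚ : ∀ a → 0ℚ ℚ.≤ nℚ a
0≤nℚ a = ℚP.nonNegative⁻¹ (nℚ a) {{ℚP.normalize-nonNeg a 1}}

÷-*-cancel : ∀ X D .{{_ : ℚ.NonZero D}} N → X ÷ D ℚ.* N ℚ.* D ≡ X ℚ.* N
÷-*-cancel X D N = begin
  X ℚ.* ℚ.1/ D ℚ.* N ℚ.* D     ≡⟨ solve 4 (λ x i n d → x :* i :* n :* d := x :* n :* (i :* d)) refl X (ℚ.1/ D) N D ⟩
  X ℚ.* N ℚ.* (ℚ.1/ D ℚ.* D)   ≡⟨ cong (X ℚ.* N ℚ.*_) (ℚP.*-inverseˡ D) ⟩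
  X ℚ.* N ℚ.* ℚ.1ℚ             ≡⟨ ℚP.*-identityʳ (X ℚ.* N) ⟩
  X ℚ.* N                      ∎
  where
  open ≡-Reasoning
  open +-*-Solver

÷-*-nonNeg : ∀ {X D N} (0<D : 0ℚ ℚ.< D) → 0ℚ ℚ.≤ X → 0ℚ ℚ.≤ N →
             0ℚ ℚ.≤ _÷_ X D {{ℚ.>-nonZero 0<D}} ℚ.* N
÷-*-nonNeg {X} {D} {N} 0<D 0≤X 0≤N = ℚP.*-cancelʳ-≤-pos D (begin
  0ℚ ℚ.* D            ≡⟨ ℚP.*-zeroˡ D ⟩
  0ℚ                  ≤⟨ ℚP.nonNegative⁻¹ (X ℚ.* N) {{ℚP.nonNeg*nonNeg⇒nonNeg X N}} ⟩
  X ℚ.* N             ≡⟨ ÷-*-cancel X D N ⟨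
  X ÷ D ℚ.* N ℚ.* D   ∎)
  where
  open ℚP.≤-Reasoning
  instance
    _ = ℚ.>-nonZero 0<D
    _ = ℚ.positive 0<D
    _ = ℚ.nonNegative 0≤X
    _ = ℚ.nonNegative 0≤N

÷-*-≤⇒*-≤ : ∀ {X E D N B M} (0<D : 0ℚ ℚ.< D) → D ≡ X ℚ.+ E → N ≡ B ℚ.+ M →
          _÷_ X D {{ℚ.>-nonZero 0<D}} ℚ.* N ℚ.≤ M → X ℚ.* B ℚ.≤ E ℚ.* M
÷-*-≤⇒*-≤ {X} {E} {D} {N} {B} {M} 0<D refl refl qN≤M = begin
  X ℚ.* B                      ≡⟨ solve 3 (λ x b m → x :* b := x :* (b :+ m) :- x :* m) refl X B M ⟩
  X ℚ.* N ℚ.- X ℚ.* M          ≡⟨ cong (ℚ._- X ℚ.* M) (÷-*-cancel X D N) ⟨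
  X ÷ D ℚ.* N ℚ.* D ℚ.- X ℚ.* M ≤⟨ ℚP.+-monoˡ-≤ (ℚ.- (X ℚ.* M)) (ℚP.*-monoʳ-≤-nonNeg D qN≤M) ⟩
  M ℚ.* D ℚ.- X ℚ.* M          ≡⟨ solve 3 (λ x e m → m :* (x :+ e) :- x :* m := e :* m) refl X E M ⟩
  E ℚ.* M                      ∎
  where
  open ℚP.≤-Reasoning
  open +-*-Solver
  instance
    _ = ℚ.>-nonZero 0<D
    _ = ℚ.positive 0<D
    _ = ℚP.pos⇒nonNeg D

-- Finite sums

sumFin-cong : ∀ n {f g : Fin n → ℕ} → (∀ x → f x ≡ g x) → sumFin n f ≡ sumFin n g
sumFin-cong zero    f≗g = refl
sumFin-cong (suc n) f≗g = cong₂ _+_ (f≗g zero) (sumFin-cong n (f≗g ∘ suc))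

sumFin-const : ∀ n c → sumFin n (λ _ → c) ≡ n * c
sumFin-const zero    c = refl
sumFin-const (suc n) c = cong (c +_) (sumFin-const n c)

sumFin-zero : ∀ n → sumFin n (λ _ → 0) ≡ 0
sumFin-zero n = trans (sumFin-const n 0) (ℕP.*-zeroʳ n)

sumFin-distrib-+ : ∀ n (f g : Fin n → ℕ) → sumFin n (λ x → f x + g x) ≡ sumFin n f + sumFin n g
sumFin-distrib-+ zero    f g = refl
sumFin-distrib-+ (suc n) f g =
  trans (cong (f zero + g zero +_) (sumFin-distrib-+ n (f ∘ suc) (g ∘ suc))) (interchange (f zero) (g zero) _ _)

sumFin-splitAt : ∀ b {m} (g : Fin b ⊎ Fin m → ℕ) →
                 sumFin (b + m) (g ∘ splitAt b) ≡ sumFin b (g ∘ inj₁) + sumFin m (g ∘ inj₂)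
sumFin-splitAt zero    g = refl
sumFin-splitAt (suc b) g =
  trans (cong (g (inj₁ zero) +_) (sumFin-splitAt b (g ∘ Sum.map₁ suc))) (sym (ℕP.+-assoc (g (inj₁ zero)) _ _))

sumFin-remQuot : ∀ r k (g : Fin r × Fin k → ℕ) →
                 sumFin (r * k) (g ∘ remQuot k) ≡ sumFin r (λ j → sumFin k (λ ℓ → g (j , ℓ)))
sumFin-remQuot zero    k g = refl
sumFin-remQuot (suc r) k g =
  -- remQuot {suc r} k, unfolded by one step
  trans (sumFin-splitAt k (g ∘ Product.swap ∘ [ (_, zero) , Product.map₂ suc ∘ quotRem {r} k ]′)) (cong (sumFin k (λ ℓ → g (zero , ℓ)) +_) (sumFin-remQuot r k (g ∘ Product.map₁ suc)))

_≡ᵇ_ : ∀ {n} → Fin n → Fin n → Bool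
i ≡ᵇ j = does (i FP.≟ j)

≡ᵇ-refl : ∀ {n} (i : Fin n) → (i ≡ᵇ i) ≡ true
≡ᵇ-refl i = dec-true (i FP.≟ i) refl

≡ᵇ-sym : ∀ {n} (i j : Fin n) → (i ≡ᵇ j) ≡ (j ≡ᵇ i)
≡ᵇ-sym i j = does-⇔ (mk⇔ sym sym) (i FP.≟ j) (j FP.≟ i)

sumFin-if-≡ᵇ : ∀ k (ℓ : Fin k) A B → sumFin k (λ ℓ' → if ℓ ≡ᵇ ℓ' then A else B) ≡ A + (k ∸ 1) * B
sumFin-if-≡ᵇ (suc k)       zero    A B = cong (A +_) (sumFin-const k B)
sumFin-if-≡ᵇ (suc (suc k)) (suc ℓ) A B =
  trans (cong (B +_) (sumFin-if-≡ᵇ (suc k) ℓ A B)) (x∙yz≈y∙xz B A _)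

-- Finite combinatorics

record Hits {N} {A C : Set} (s : ℕ) (f : Fin N → C) (ι : A → C) : Set where
  constructor hits
  field
    index           : Fin s → Fin N
    value           : Fin s → A
    index-injective : Injective _≡_ _≡_ index
    hit             : ∀ i → f (index i) ≡ ι (value i)

hits-none : ∀ {N} {A C : Set} {f : Fin N → C} {ι : A → C} → Hits 0 f ι
hits-none = hits (λ ()) (λ ()) (λ { {()} }) λ ()

module _ {N} {A C : Set} {f : Fin (suc N) → C} {ι : A → C} where

  hits-tail : ∀ {s} → Hits s (f ∘ suc) ι → Hits s f ι
  hits-tail (hits g v g-inj fg≡ιv) = hits (suc ∘ g) v (g-inj ∘ FP.suc-injective) fg≡ιv

  hits-cons : ∀ {s v₀} → f zero ≡ ι v₀ → Hits s (f ∘ suc) ι → Hits (suc s) f ι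
  hits-cons {v₀ = v₀} f₀≡ιv₀ (hits g v g-inj fg≡ιv) =
    hits (lift 1 g) (λ { zero → v₀ ; (suc i) → v i }) (FP.lift-injective g g-inj 1)
         (λ { zero → f₀≡ιv₀ ; (suc i) → fg≡ιv i })

pigeonhole-⊎ : ∀ {N} {A B : Set} a c → a + c ≡ suc N → (f : Fin N → A ⊎ B) →
               Hits a f inj₁ ⊎ Hits c f inj₂
pigeonhole-⊎         zero    c       _  f = inj₁ hits-none
pigeonhole-⊎         (suc a) zero    _  f = inj₂ hits-none
pigeonhole-⊎ {zero}  (suc a) (suc c) eq f =
  contradiction (trans (sym (ℕP.+-suc a c)) (ℕP.suc-injective eq)) λ ()
pigeonhole-⊎ {suc N} (suc a) (suc c) eq f with f zero in f₀≡
... | inj₁ _ = Sum.map (hits-cons f₀≡) hits-tail (pigeonhole-⊎ a (suc c) (ℕP.suc-injective eq) (f ∘ suc))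
... | inj₂ _ = Sum.map hits-tail (hits-cons f₀≡)
                 (pigeonhole-⊎ (suc a) c (ℕP.suc-injective (trans (sym (ℕP.+-suc (suc a) c)) eq)) (f ∘ suc))

remQuot-injective : ∀ {r} k {p p' : Fin (r * k)} → remQuot {r} k p ≡ remQuot k p' → p ≡ p'
remQuot-injective {r} k {p} {p'} eq =
  trans (sym (FP.combine-remQuot {r} k p)) (trans (cong (uncurry combine) eq) (FP.combine-remQuot {r} k p'))

-- The layered graph

-- Block (j , ℓ) is part j of layer ℓ. A slot is either a vertex of G₀ (inj₁) or one of the
-- m padding vertices (inj₂).
module Layered {r k b m : ℕ} (G₀ : PGraph r b) where

  Block : Set
  Block = Fin r × Fin k

  Slot : Set
  Slot = Fin b ⊎ Fin m

  layeredAdj : Block → Slot → Block → Slot → Bool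
  layeredAdj (j , ℓ) (inj₁ x) (j' , ℓ') (inj₁ x') = if ℓ ≡ᵇ ℓ' then adj G₀ j x j' x' else true
  layeredAdj (j , ℓ) (inj₂ _) (j' , ℓ') (inj₂ _)  = if ℓ ≡ᵇ ℓ' then not (j ≡ᵇ j') else false
  layeredAdj _       (inj₁ _) _         (inj₂ _)  = false
  layeredAdj _       (inj₂ _) _         (inj₁ _)  = false

  layeredAdj-sym : ∀ c s c' s' → layeredAdj c s c' s' ≡ layeredAdj c' s' c s
  layeredAdj-sym (j , ℓ) (inj₁ x) (j' , ℓ') (inj₁ x')
    rewrite ≡ᵇ-sym ℓ ℓ' | adj-sym G₀ j x j' x' = refl
  layeredAdj-sym (j , ℓ) (inj₂ _) (j' , ℓ') (inj₂ _)
    rewrite ≡ᵇ-sym ℓ ℓ' | ≡ᵇ-sym j j' = refl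
  layeredAdj-sym _ (inj₁ _) _ (inj₂ _) = refl
  layeredAdj-sym _ (inj₂ _) _ (inj₁ _) = refl

  layeredAdj-sameBlock : ∀ c s s' → layeredAdj c s c s' ≡ false
  layeredAdj-sameBlock (j , ℓ) (inj₁ x) (inj₁ x') rewrite ≡ᵇ-refl ℓ = part-indep G₀ j x x'
  layeredAdj-sameBlock (j , ℓ) (inj₂ _) (inj₂ _)  rewrite ≡ᵇ-refl ℓ | ≡ᵇ-refl j = refl
  layeredAdj-sameBlock _ (inj₁ _) (inj₂ _) = refl
  layeredAdj-sameBlock _ (inj₂ _) (inj₁ _) = refl

  layered : PGraph (r * k) (b + m)
  adj        layered p a p' a' = layeredAdj (remQuot k p) (splitAt b a) (remQuot k p') (splitAt b a')
  adj-sym    layered p a p' a' = layeredAdj-sym (remQuot k p) (splitAt b a) (remQuot k p') (splitAt b a')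
  part-indep layered p a a'    = layeredAdj-sameBlock (remQuot k p) (splitAt b a) (splitAt b a')

  edge : Block → Slot → Block → Slot → ℕ
  edge c s c' s' = if layeredAdj c s c' s' then 1 else 0

  blockDeg : Block → Slot → Block → ℕ
  blockDeg c s c' = sumFin b (edge c s c' ∘ inj₁) + sumFin m (edge c s c' ∘ inj₂)

  blocksDeg : Block → Slot → ℕ
  blocksDeg c s = sumFin r (λ j' → sumFin k (λ ℓ' → blockDeg c s (j' , ℓ')))

  deg-layered : ∀ p a → deg layered p a ≡ blocksDeg (remQuot k p) (splitAt b a)
  deg-layered p a =
    trans (sumFin-remQuot r k (λ c' → sumFin (b + m) (edge c s c' ∘ splitAt b)))
          (sumFin-cong r λ j' → sumFin-cong k λ ℓ' → sumFin-splitAt b (edge c s (j' , ℓ')))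
    where
    c = remQuot k p
    s = splitAt b a

  blockDeg-inj₁ : ∀ j ℓ x j' ℓ' → blockDeg (j , ℓ) (inj₁ x) (j' , ℓ') ≡
                  (if ℓ ≡ᵇ ℓ' then sumFin b (λ x' → if adj G₀ j x j' x' then 1 else 0) else b)
  blockDeg-inj₁ j ℓ x j' ℓ' with ℓ ≡ᵇ ℓ'
  ... | true  = trans (cong (_ +_) (sumFin-zero m)) (ℕP.+-identityʳ _)
  ... | false = trans (cong₂ _+_ (sumFin-const b 1) (sumFin-zero m))
                      (trans (ℕP.+-identityʳ _) (ℕP.*-identityʳ b))

  blockDeg-inj₂ : ∀ j ℓ y j' ℓ' → blockDeg (j , ℓ) (inj₂ y) (j' , ℓ') ≡
                  (if ℓ ≡ᵇ ℓ' then (if j ≡ᵇ j' then 0 else m) else 0)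
  blockDeg-inj₂ j ℓ y j' ℓ' with ℓ ≡ᵇ ℓ' | j ≡ᵇ j'
  ... | true  | true  = cong₂ _+_ (sumFin-zero b) (sumFin-zero m)
  ... | true  | false = cong₂ _+_ (sumFin-zero b) (trans (sumFin-const m 1) (ℕP.*-identityʳ m))
  ... | false | _     = cong₂ _+_ (sumFin-zero b) (sumFin-zero m)

  blocksDeg-inj₁ : ∀ j ℓ x → blocksDeg (j , ℓ) (inj₁ x) ≡ deg G₀ j x + r * ((k ∸ 1) * b)
  blocksDeg-inj₁ j ℓ x = begin
    blocksDeg (j , ℓ) (inj₁ x)
      ≡⟨ sumFin-cong r (λ j' → trans (sumFin-cong k (blockDeg-inj₁ j ℓ x j')) (sumFin-if-≡ᵇ k ℓ _ b)) ⟩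
    sumFin r (λ j' → sumFin b (λ x' → if adj G₀ j x j' x' then 1 else 0) + (k ∸ 1) * b)
      ≡⟨ sumFin-distrib-+ r _ _ ⟩
    deg G₀ j x + sumFin r (λ _ → (k ∸ 1) * b)
      ≡⟨ cong (deg G₀ j x +_) (sumFin-const r _) ⟩
    deg G₀ j x + r * ((k ∸ 1) * b)
      ∎
    where open ≡-Reasoning

  blocksDeg-inj₂ : ∀ j ℓ y → blocksDeg (j , ℓ) (inj₂ y) ≡ (r ∸ 1) * m
  blocksDeg-inj₂ j ℓ y = begin
    blocksDeg (j , ℓ) (inj₂ y)
      ≡⟨ sumFin-cong r (λ j' → trans (sumFin-cong k (blockDeg-inj₂ j ℓ y j')) (sumFin-if-≡ᵇ k ℓ _ 0)) ⟩
    sumFin r (λ j' → (if j ≡ᵇ j' then 0 else m) + (k ∸ 1) * 0)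
      ≡⟨ sumFin-cong r (λ j' → trans (cong ((if j ≡ᵇ j' then 0 else m) +_) (ℕP.*-zeroʳ (k ∸ 1)))
                                     (ℕP.+-identityʳ _)) ⟩
    sumFin r (λ j' → if j ≡ᵇ j' then 0 else m)
      ≡⟨ sumFin-if-≡ᵇ r j 0 m ⟩
    (r ∸ 1) * m
      ∎
    where open ≡-Reasoning

  layered-maxDeg : ∀ {D} → (∀ j x → deg G₀ j x + r * ((k ∸ 1) * b) ≤ D) → (r ∸ 1) * m ≤ D →
                   ∀ p a → deg layered p a ≤ D
  layered-maxDeg {D} G₀-bound padding-bound p a =
    subst (_≤ D) (sym (deg-layered p a)) (blocksDeg-≤ (remQuot k p) (splitAt b a))
    where
    blocksDeg-≤ : ∀ c s → blocksDeg c s ≤ D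
    blocksDeg-≤ (j , ℓ) (inj₁ x) = subst (_≤ D) (sym (blocksDeg-inj₁ j ℓ x)) (G₀-bound j x)
    blocksDeg-≤ (j , ℓ) (inj₂ y) = subst (_≤ D) (sym (blocksDeg-inj₂ j ℓ y)) padding-bound

  nonadjacent-inj₁ : ∀ {c c' x x'} → layeredAdj c (inj₁ x) c' (inj₁ x') ≡ false →
                     proj₂ c ≡ proj₂ c' × adj G₀ (proj₁ c) x (proj₁ c') x' ≡ false
  nonadjacent-inj₁ {_ , ℓ} {_ , ℓ'} nonadj with ℓ FP.≟ ℓ'
  ... | yes ℓ≡ℓ' = ℓ≡ℓ' , nonadj
  ... | no  _    = contradiction nonadj λ ()

  nonadjacent-inj₂ : ∀ {c c' y y'} → layeredAdj c (inj₂ y) c' (inj₂ y') ≡ false →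
                     proj₂ c ≡ proj₂ c' → proj₁ c ≡ proj₁ c'
  nonadjacent-inj₂ {j , ℓ} {j' , ℓ'} nonadj ℓ≡ℓ' with ℓ FP.≟ ℓ' | j FP.≟ j'
  ... | _     | yes j≡j' = j≡j'
  ... | yes _ | no  _    = contradiction nonadj λ ()
  ... | no ℓ≢ℓ' | no _   = contradiction ℓ≡ℓ' ℓ≢ℓ'

  layered-noCrossingIndep : ∀ {t} → ¬ HasCrossingIndep G₀ t → ¬ HasCrossingIndep layered (k + t)
  layered-noCrossingIndep {t} noG₀ (part , vtx , distinct , indep) =
    [ G₀-case , padding-case ]′ (pigeonhole-⊎ t (suc k) size (splitAt b ∘ vtx))
    where
    size : t + suc k ≡ suc (k + t)
    size = trans (ℕP.+-suc t k) (cong suc (ℕP.+-comm t k))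

    block : Fin (k + t) → Block
    block = remQuot k ∘ part

    distinctBlocks : ∀ {s s'} → s ≢ s' → block s ≢ block s'
    distinctBlocks {s} {s'} s≢s' = distinct s s' s≢s' ∘ remQuot-injective k

    nonadj : ∀ {s s' σ σ'} → s ≢ s' → splitAt b (vtx s) ≡ σ → splitAt b (vtx s') ≡ σ' →
             layeredAdj (block s) σ (block s') σ' ≡ false
    nonadj {s} {s'} s≢s' refl refl = indep s s' s≢s'

    G₀-case : Hits t (splitAt b ∘ vtx) inj₁ → ⊥
    G₀-case (hits g x g-inj gx) = noG₀ (proj₁ ∘ block ∘ g , x , distinct₀ , indep₀)
      where
      nonadj₀ : ∀ i i' → i ≢ i' → proj₂ (block (g i)) ≡ proj₂ (block (g i')) ×
                adj G₀ (proj₁ (block (g i))) (x i) (proj₁ (block (g i'))) (x i') ≡ false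
      nonadj₀ i i' i≢i' = nonadjacent-inj₁ (nonadj (i≢i' ∘ g-inj) (gx i) (gx i'))
      distinct₀ : ∀ i i' → i ≢ i' → proj₁ (block (g i)) ≢ proj₁ (block (g i'))
      distinct₀ i i' i≢i' sameColumn =
        distinctBlocks (i≢i' ∘ g-inj) (cong₂ _,_ sameColumn (proj₁ (nonadj₀ i i' i≢i')))
      indep₀ : ∀ i i' → i ≢ i' → adj G₀ (proj₁ (block (g i))) (x i) (proj₁ (block (g i'))) (x i') ≡ false
      indep₀ i i' i≢i' = proj₂ (nonadj₀ i i' i≢i')

    padding-case : Hits (suc k) (splitAt b ∘ vtx) inj₂ → ⊥
    padding-case (hits h y h-inj hy)
      with i , i' , i<i' , sameLayer ← FP.pigeonhole (ℕP.n<1+n k) (proj₂ ∘ block ∘ h) =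
      distinctBlocks h≢ (cong₂ _,_ sameColumn sameLayer)
      where
      h≢ : h i ≢ h i'
      h≢ = FP.<⇒≢ i<i' ∘ h-inj
      sameColumn : proj₁ (block (h i)) ≡ proj₁ (block (h i'))
      sameColumn = nonadjacent-inj₂ {y = y i} {y' = y i'} (nonadj h≢ (hy i) (hy i')) sameLayer

emptyParts : ∀ r → PGraph r 0
adj        (emptyParts r) _ () _ _
adj-sym    (emptyParts r) _ () _ _
part-indep (emptyParts r) _ () _

emptyParts-noCrossingIndep : ∀ {r s} → 1 ≤ s → ¬ HasCrossingIndep (emptyParts r) s
emptyParts-noCrossingIndep (s≤s _) (_ , vtx , _) with () ← vtx zero

den≡num+ : ∀ Δ₀ r₀ k → 1 ≤ r₀ → 1 ≤ k → den Δ₀ r₀ k ≡ num Δ₀ r₀ k ℚ.+ nℚ (r₀ ∸ 1)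
den≡num+ Δ₀ (suc r) (suc k) _ _ = begin
  Δ₀ ℚ.+ nℚ (r + k * suc r)          ≡⟨ cong (λ z → Δ₀ ℚ.+ nℚ z) (ℕP.+-comm r (k * suc r)) ⟩
  Δ₀ ℚ.+ nℚ (k * suc r + r)          ≡⟨ cong (Δ₀ ℚ.+_) (nℚ-+ (k * suc r) r) ⟩
  Δ₀ ℚ.+ (nℚ (k * suc r) ℚ.+ nℚ r)   ≡⟨ ℚP.+-assoc Δ₀ _ _ ⟨
  Δ₀ ℚ.+ nℚ (k * suc r) ℚ.+ nℚ r     ∎
  where open ≡-Reasoning

padding-size : ∀ Δ₀ r₀ k n → 0ℚ ℚ.≤ Δ₀ → 1 ≤ r₀ → 1 ≤ k → (0<den : 0ℚ ℚ.< den Δ₀ r₀ k) →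
  ∃ λ m → ℤ.+ ((r₀ ∸ 1) * m) ≡ bound Δ₀ r₀ k n 0<den ×
          (∀ b → b + m ≡ n → num Δ₀ r₀ k ℚ.* nℚ b ℚ.≤ nℚ (r₀ ∸ 1) ℚ.* nℚ m)
padding-size Δ₀ r₀ k n 0≤Δ₀ 1≤r₀ 1≤k 0<den = m , bound≡ , share
  where
  instance _ = ℚ.>-nonZero 0<den
  x = num Δ₀ r₀ k ÷ den Δ₀ r₀ k ℚ.* nℚ n
  m = ∣ ceiling x ∣
  m≡⌈x⌉ : ℤ.+ m ≡ ceiling x
  m≡⌈x⌉ = ceiling-nonNeg (÷-*-nonNeg 0<den (ℚP.+-mono-≤ 0≤Δ₀ (0≤nℚ ((k ∸ 1) * r₀))) (0≤nℚ n))
  bound≡ : ℤ.+ ((r₀ ∸ 1) * m) ≡ bound Δ₀ r₀ k n 0<den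
  bound≡ = trans (ℤP.pos-* (r₀ ∸ 1) m) (cong (ℤ.+ (r₀ ∸ 1) ℤ.*_) m≡⌈x⌉)
  share : ∀ b → b + m ≡ n → num Δ₀ r₀ k ℚ.* nℚ b ℚ.≤ nℚ (r₀ ∸ 1) ℚ.* nℚ m
  share b b+m≡n =
    ÷-*-≤⇒*-≤ {num Δ₀ r₀ k} {nℚ (r₀ ∸ 1)} {den Δ₀ r₀ k} {nℚ n} {nℚ b} {nℚ m} 0<den
      (den≡num+ Δ₀ r₀ k 1≤r₀ 1≤k) (trans (cong nℚ (sym b+m≡n)) (nℚ-+ b m))
      (subst (λ c → x ℚ.≤ c / 1) (sym m≡⌈x⌉) (≤-ceiling x))

G₀-vertex-bound : ∀ {Δ₀ : ℚ} r₀ k {b m d} → nℚ d ℚ.≤ Δ₀ ℚ.* nℚ b →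
  num Δ₀ r₀ k ℚ.* nℚ b ℚ.≤ nℚ (r₀ ∸ 1) ℚ.* nℚ m → d + r₀ * ((k ∸ 1) * b) ≤ (r₀ ∸ 1) * m
G₀-vertex-bound {Δ₀} r₀ k {b} {m} {d} d≤Δ₀b share = nℚ-cancel-≤ (begin
  nℚ (d + r₀ * ((k ∸ 1) * b))      ≡⟨ nℚ-+ d _ ⟩
  nℚ d ℚ.+ nℚ (r₀ * ((k ∸ 1) * b)) ≡⟨ cong (nℚ d ℚ.+_) (trans (cong nℚ reassoc) (nℚ-* K b)) ⟩
  nℚ d ℚ.+ nℚ K ℚ.* nℚ b           ≤⟨ ℚP.+-monoˡ-≤ (nℚ K ℚ.* nℚ b) d≤Δ₀b ⟩
  Δ₀ ℚ.* nℚ b ℚ.+ nℚ K ℚ.* nℚ b    ≡⟨ ℚP.*-distribʳ-+ (nℚ b) Δ₀ (nℚ K) ⟨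
  num Δ₀ r₀ k ℚ.* nℚ b             ≤⟨ share ⟩
  nℚ (r₀ ∸ 1) ℚ.* nℚ m             ≡⟨ nℚ-* (r₀ ∸ 1) m ⟨
  nℚ ((r₀ ∸ 1) * m)                ∎)
  where
  open ℚP.≤-Reasoning
  K = (k ∸ 1) * r₀
  reassoc : r₀ * ((k ∸ 1) * b) ≡ K * b
  reassoc = trans (sym (ℕP.*-assoc r₀ (k ∸ 1) b)) (cong (_* b) (ℕP.*-comm r₀ (k ∸ 1)))

layered-construction : ∀ {Δ₀ : ℚ} {r₀ t₀ k n m} →
  (∀ b → ∃ λ (G₀ : PGraph r₀ b) → ¬ HasCrossingIndep G₀ t₀ × MaxDeg≤ℚ G₀ (Δ₀ ℚ.* nℚ b)) →
  (∀ b → b + m ≡ n → num Δ₀ r₀ k ℚ.* nℚ b ℚ.≤ nℚ (r₀ ∸ 1) ℚ.* nℚ m) →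
  ∃ λ (G : PGraph (r₀ * k) n) → ¬ HasCrossingIndep G (k + t₀) × MaxDeg≤ℤ G (ℤ.+ ((r₀ ∸ 1) * m))
layered-construction {Δ₀} {r₀} {t₀} {k} {n} {m} base share =
  subst (λ n′ → ∃ λ (G : PGraph (r₀ * k) n′) →
                   ¬ HasCrossingIndep G (k + t₀) × MaxDeg≤ℤ G (ℤ.+ ((r₀ ∸ 1) * m)))
        (trans (ℕP.+-comm b (m ⊓ n)) (ℕP.m⊓n+n∸m≡n m n))
        (layered G₀ , layered-noCrossingIndep G₀ noG₀ ,
         λ p a → ℤ.+≤+ (layered-maxDeg G₀ G₀-bound pad-bound p a))
  where
  open Layered
  b = n ∸ m
  G₀ = proj₁ (base b)
  noG₀ = proj₁ (proj₂ (base b))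
  -- G₀ has a vertex only when m < n, and then b + m = n.
  b+m≡n : Fin b → b + m ≡ n
  b+m≡n x = ℕP.m∸n+n≡m {n} {m} (ℕP.<⇒≤ (ℕP.m∸n≢0⇒n<m (ℕ.≢-nonZero⁻¹ b {{FP.nonZeroIndex x}})))
  G₀-bound : ∀ j x → deg G₀ j x + r₀ * ((k ∸ 1) * b) ≤ (r₀ ∸ 1) * m
  G₀-bound j x = G₀-vertex-bound {Δ₀} r₀ k (proj₂ (proj₂ (base b)) j x) (share b (b+m≡n x))
  pad-bound : (r₀ ∸ 1) * (m ⊓ n) ≤ (r₀ ∸ 1) * m
  pad-bound = ℕP.*-monoʳ-≤ (r₀ ∸ 1) (ℕP.m⊓n≤m m n)

proposition7p1 : (r₀ t₀ : ℕ) (h2t : 2 ≤ t₀) (htr : t₀ ≤ r₀)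
    (Δ₀ : ℚ) (hΔ : 0ℚ ℚ.≤ Δ₀)
    → (∀ (n₀ : ℕ) → 1 ≤ n₀ → ∃ λ (G : PGraph r₀ n₀) → ¬ HasCrossingIndep G t₀ × MaxDeg≤ℚ G (Δ₀ ℚ.* nℚ n₀))
    → (n k : ℕ) → 2 ≤ n → (hk : 2 ≤ k)
    → ∃ λ (G : PGraph (r₀ * k) n) → ¬ HasCrossingIndep G (k + t₀) × MaxDeg≤ℤ G (bound Δ₀ r₀ k n (den-pos Δ₀ r₀ k hΔ (≤-trans h2t htr) hk))
proposition7p1 r₀ t₀ h2t htr Δ₀ hΔ hyp n k _ hk =
  let m , m-bound , share = padding-size Δ₀ r₀ k n hΔ (ℕP.<⇒≤ (≤-trans h2t htr)) (ℕP.<⇒≤ hk)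
                                          (den-pos Δ₀ r₀ k hΔ (≤-trans h2t htr) hk)
  in subst (λ B → ∃ λ (G : PGraph (r₀ * k) n) → ¬ HasCrossingIndep G (k + t₀) × MaxDeg≤ℤ G B)
          m-bound (layered-construction {Δ₀} {r₀} {t₀} {k} {n} {m} base share)
  where
  base : ∀ b → ∃ λ (G₀ : PGraph r₀ b) → ¬ HasCrossingIndep G₀ t₀ × MaxDeg≤ℚ G₀ (Δ₀ ℚ.* nℚ b)
  base zero    = emptyParts r₀ , emptyParts-noCrossingIndep (≤-trans (s≤s z≤n) h2t) , λ _ ()
  base (suc b) = hyp (suc b) (s≤s z≤n)
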